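{- Let $b$ and $l\ge1$ be integers with $b<0$ or $b\ge l$. Let $\mathbf v=(v_1,\dots,v_{2l})\in\mathbb{Z}^{2l}$ and let $q$ be a prime with $q>|b|$ and $q>2l$. If the rational function \[P_{\mathbf v}(T)=\sum_{i=1}^l\left((T+v_i)^b-(T+v_{l+i})^b\right)\] vanishes identically over $\mathbb{F}_q$, then for every $1\le i\le l$ there exists $1\le h\le l$ such that $v_i\equiv v_{l+h}\pmod q$.
   Context: "Vanishes identically over $\mathbb{F}_q$" means that $P_{\mathbf v}$, reduced modulo $q$, is the zero element of $\mathbb{F}_q(T)$. -}

module Defs where

open import Data.Nat as ℕ using (ℕ; zero; suc)
open import Data.Integer using (ℤ; +_; -[1+_]; _+_; _*_; -_)
open import Data.Integer.Divisibility using (_∣_)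
open import Data.List using (List; []; _∷_; map; foldr; allFin)
open import Data.List.Relation.Unary.All using (All)
open import Data.Fin using (Fin; _↑ˡ_; _↑ʳ_)
open import Data.Product using (_×_; _,_)

-- Polynomials with integer coefficients, as coefficient lists (constant term first).
Poly : Set
Poly = List ℤ

infixl 6 _⊕_
infixl 7 _⊗_

_⊕_ : Poly → Poly → Poly
[] ⊕ q = q
(a ∷ p) ⊕ [] = a ∷ p
(a ∷ p) ⊕ (b ∷ q) = (a + b) ∷ (p ⊕ q)

scale : ℤ → Poly → Poly
scale c = map (c *_)

_⊗_ : Poly → Poly → Poly
[] ⊗ q = []
(a ∷ p) ⊗ q = scale a q ⊕ (+ 0 ∷ (p ⊗ q))

pow : Poly → ℕ → Poly
pow p zero = + 1 ∷ []
pow p (suc n) = p ⊗ pow p n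

Frac : Set
Frac = Poly × Poly

zeroF : Frac
zeroF = [] , (+ 1 ∷ [])

_+F_ : Frac → Frac → Frac
(n₁ , d₁) +F (n₂ , d₂) = (n₁ ⊗ d₂ ⊕ n₂ ⊗ d₁) , (d₁ ⊗ d₂)

negF : Frac → Frac
negF (n , d) = scale (-[1+ 0 ]) n , d

_-F_ : Frac → Frac → Frac
x -F y = x +F negF y

powF : Frac → ℤ → Frac
powF (n , d) (+ k) = pow n k , pow d k
powF (n , d) -[1+ k ] = pow d (suc k) , pow n (suc k)

linF : ℤ → Frac
linF v = (v ∷ + 1 ∷ []) , (+ 1 ∷ [])

-- P_v(T) = Σ_{i=1}^l ((T+v_i)^b - (T+v_{l+i})^b), with v indexed by Fin (l + l):
-- v_i = v (i ↑ˡ l), v_{l+i} = v (l ↑ʳ i).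
Pv : (l : ℕ) → ℤ → (Fin (l ℕ.+ l) → ℤ) → Frac
Pv l b v = foldr _+F_ zeroF
  (map (λ i → powF (linF (v (i ↑ˡ l))) b -F powF (linF (v (l ↑ʳ i))) b) (allFin l))

PolyVanishesMod : ℕ → Poly → Set
PolyVanishesMod q p = All (λ c → (+ q) ∣ c) p

-- A fraction N/D (D monic here, hence nonzero mod q) is zero in F_q(T) iff N ≡ 0 in F_q[T]
-- (N/D = 0/1  ⇔  N·1 = 0·D).
FracVanishesMod : ℕ → Frac → Set
FracVanishesMod q (n , d) = PolyVanishesMod q n

-- Fix i, put x₀ = v_i and suppose that no v_{l+h} is congruent to x₀ modulo q. Evaluating
-- numerator and denominator of P_v at the power series X + t with t = −x₀ expands P_v around
-- x₀, and the question becomes one about low-order coefficients modulo q.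
--
-- b = −m < 0: after multiplication by X^m, each (T + v)^b contributes 1 + O(X) if v ≡ x₀ and
-- O(X^m) otherwise, so X^m P_v(X − x₀) ≡ r + O(X), where 1 ≤ r ≤ l < q counts the indices
-- i ≤ l with v_i ≡ x₀. Hence P_v does not vanish modulo q.
--
-- b = m ≥ l: with u_i = v_i − x₀, w_h = v_{l+h} − x₀ and p_e the e-th power sum, the
-- coefficient of X^(m−e) in P_v(X − x₀) is C(m, e)(p_e(u) − p_e(w)). For m < q the binomial
-- coefficients are units, so p_e(u) ≡ p_e(w) for e ≤ l, and Newton's identities (l < q) make
-- all elementary symmetric functions agree, in particular ∏ u_i ≡ ∏ w_h. But u_i = 0 while no
-- w_h is divisible by q.

{-# OPTIONS --safe #-}
module Submission where

open import Defs
open import Data.Nat as ℕ using (ℕ; zero; suc; _≤_; _<_; _≤?_; z≤n; s≤s; _∸_; _!)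
import Data.Nat.Properties as ℕ
import Data.Nat.Divisibility as ℕ
open import Data.Nat.Combinatorics using (_C_; k>n⇒nCk≡0; nCk+nC[k+1]≡[n+1]C[k+1]; nCk≡n!/k![n-k]!; k![n∸k]!∣n!)
open import Data.Nat.Primality using (Prime; euclidsLemma; prime⇒nonTrivial)
open import Data.Integer as ℤ using (ℤ; +_; -[1+_]; _+_; _-_; _*_; -_; 0ℤ; 1ℤ; -1ℤ; _^_)
import Data.Integer.Properties as ℤ
import Data.Integer.Divisibility as Unsigned
import Data.Integer.Divisibility.Signed as Signed
open import Data.Integer.Tactic.RingSolver using (solve-∀)
open import Data.Fin.Properties using (any?)
open import Data.List using (List; []; _∷_; length; map; foldr; allFin)
open import Data.List.Properties using (length-map; length-tabulate)
open import Data.List.Relation.Unary.All as All using (All; []; _∷_)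
import Data.List.Relation.Unary.All.Properties as All
open import Data.List.Relation.Unary.Any as Any using (Any; here; there)
import Data.List.Relation.Unary.Any.Properties as Any
open import Data.List.Membership.Propositional.Properties using (∈-allFin)
open import Data.Product using (_,_; proj₁; proj₂)
open import Data.Sum using (_⊎_; inj₁; inj₂)
open import Data.Empty using (⊥-elim)
open import Function using (_∘_)
open import Relation.Nullary using (¬_; Dec; yes; no)
open import Relation.Nullary.Decidable using (decidable-stable)
open import Relation.Binary.Bundles using (Setoid)
open import Relation.Binary.PropositionalEquality

[a+b]c+[x+y]≡[ac+x]+[bc+y] : ∀ a b c x y → (a + b) * c + (x + y) ≡ (a * c + x) + (b * c + y)
[a+b]c+[x+y]≡[ac+x]+[bc+y] = solve-∀

[ca]b+cx≡c[ab+x] : ∀ c a b x → (c * a) * b + c * x ≡ c * (a * b + x)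
[ca]b+cx≡c[ab+x] = solve-∀

-- Formal power series over ℤ

Series : Set
Series = ℕ → ℤ

infixl 6 _+ˢ_
infixl 7 _*ˢ_ _·ˢ_
infixr 8 _^ˢ_

_+ˢ_ : Series → Series → Series
(f +ˢ g) i = f i + g i

_·ˢ_ : ℤ → Series → Series
(c ·ˢ f) i = c * f i

0ˢ : Series
0ˢ _ = 0ℤ

1ˢ : Series
1ˢ zero = 1ℤ
1ˢ (suc _) = 0ℤ

X : Series
X 1 = 1ℤ
X _ = 0ℤ

tailˢ : Series → Series
tailˢ f i = f (suc i)

_*ˢ_ : Series → Series → Series
(f *ˢ g) zero = f 0 * g 0
(f *ˢ g) (suc k) = f 0 * g (suc k) + (tailˢ f *ˢ g) k

_^ˢ_ : Series → ℕ → Series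
f ^ˢ zero = 1ˢ
f ^ˢ suc n = f *ˢ f ^ˢ n

*ˢ-cong : ∀ {f f′ g g′} → f ≗ f′ → g ≗ g′ → f *ˢ g ≗ f′ *ˢ g′
*ˢ-cong f≗ g≗ zero = cong₂ _*_ (f≗ 0) (g≗ 0)
*ˢ-cong f≗ g≗ (suc k) = cong₂ _+_ (cong₂ _*_ (f≗ 0) (g≗ (suc k))) (*ˢ-cong (f≗ ∘ suc) g≗ k)

*ˢ-congˡ : ∀ {f f′} g → f ≗ f′ → f *ˢ g ≗ f′ *ˢ g
*ˢ-congˡ g f≗ = *ˢ-cong f≗ (λ _ → refl)

*ˢ-congʳ : ∀ f {g g′} → g ≗ g′ → f *ˢ g ≗ f *ˢ g′
*ˢ-congʳ f g≗ = *ˢ-cong (λ _ → refl) g≗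

^ˢ-congˡ : ∀ {f g} n → f ≗ g → f ^ˢ n ≗ g ^ˢ n
^ˢ-congˡ zero f≗g i = refl
^ˢ-congˡ (suc n) f≗g = *ˢ-cong f≗g (^ˢ-congˡ n f≗g)

*ˢ-distribʳ-+ˢ : ∀ h f g → (f +ˢ g) *ˢ h ≗ f *ˢ h +ˢ g *ˢ h
*ˢ-distribʳ-+ˢ h f g zero = ℤ.*-distribʳ-+ (h 0) (f 0) (g 0)
*ˢ-distribʳ-+ˢ h f g (suc k) = begin
    (f 0 + g 0) * h (suc k) + ((tailˢ f +ˢ tailˢ g) *ˢ h) k
  ≡⟨ cong (_+_ ((f 0 + g 0) * h (suc k))) (*ˢ-distribʳ-+ˢ h (tailˢ f) (tailˢ g) k) ⟩
    (f 0 + g 0) * h (suc k) + ((tailˢ f *ˢ h) k + (tailˢ g *ˢ h) k)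
  ≡⟨ [a+b]c+[x+y]≡[ac+x]+[bc+y] (f 0) (g 0) (h (suc k)) _ _ ⟩
    (f 0 * h (suc k) + (tailˢ f *ˢ h) k) + (g 0 * h (suc k) + (tailˢ g *ˢ h) k)
  ∎
  where open ≡-Reasoning

·ˢ-*ˢ-assoc : ∀ c f g → (c ·ˢ f) *ˢ g ≗ c ·ˢ (f *ˢ g)
·ˢ-*ˢ-assoc c f g zero = ℤ.*-assoc c (f 0) (g 0)
·ˢ-*ˢ-assoc c f g (suc k) =
  trans (cong (_+_ ((c * f 0) * g (suc k))) (·ˢ-*ˢ-assoc c (tailˢ f) g k))
        ([ca]b+cx≡c[ab+x] c (f 0) (g (suc k)) _)

*ˢ-zeroˡ : ∀ g → 0ˢ *ˢ g ≗ 0ˢ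
*ˢ-zeroˡ g zero = ℤ.*-zeroˡ (g 0)
*ˢ-zeroˡ g (suc k) = cong₂ _+_ (ℤ.*-zeroˡ (g (suc k))) (*ˢ-zeroˡ g k)

*ˢ-identityˡ : ∀ g → 1ˢ *ˢ g ≗ g
*ˢ-identityˡ g zero = ℤ.*-identityˡ (g 0)
*ˢ-identityˡ g (suc k) =
  trans (cong₂ _+_ (ℤ.*-identityˡ (g (suc k))) (*ˢ-zeroˡ g k)) (ℤ.+-identityʳ _)

*ˢ-suc : ∀ f g k → (f *ˢ g) (suc k) ≡ f (suc k) * g 0 + (f *ˢ tailˢ g) k
*ˢ-suc f g zero = ℤ.+-comm (f 0 * g 1) (f 1 * g 0)
*ˢ-suc f g (suc k) =
  trans (cong (_+_ (f 0 * g (suc (suc k)))) (*ˢ-suc (tailˢ f) g k))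
        (swap (f 0 * g (suc (suc k))) (f (suc (suc k)) * g 0) _)
  where
  swap : ∀ a b c → a + (b + c) ≡ b + (a + c)
  swap = solve-∀

*ˢ-comm : ∀ f g → f *ˢ g ≗ g *ˢ f
*ˢ-comm f g zero = ℤ.*-comm (f 0) (g 0)
*ˢ-comm f g (suc k) =
  trans (cong₂ _+_ (ℤ.*-comm (f 0) (g (suc k))) (*ˢ-comm (tailˢ f) g k)) (sym (*ˢ-suc g f k))

*ˢ-distribˡ-+ˢ : ∀ h f g → h *ˢ (f +ˢ g) ≗ h *ˢ f +ˢ h *ˢ g
*ˢ-distribˡ-+ˢ h f g k = begin
  (h *ˢ (f +ˢ g)) k           ≡⟨ *ˢ-comm h (f +ˢ g) k ⟩
  ((f +ˢ g) *ˢ h) k           ≡⟨ *ˢ-distribʳ-+ˢ h f g k ⟩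
  (f *ˢ h) k + (g *ˢ h) k     ≡⟨ cong₂ _+_ (*ˢ-comm f h k) (*ˢ-comm g h k) ⟩
  (h *ˢ f) k + (h *ˢ g) k     ∎
  where open ≡-Reasoning

*ˢ-zeroʳ : ∀ f → f *ˢ 0ˢ ≗ 0ˢ
*ˢ-zeroʳ f k = trans (*ˢ-comm f 0ˢ k) (*ˢ-zeroˡ f k)

*ˢ-identityʳ : ∀ f → f *ˢ 1ˢ ≗ f
*ˢ-identityʳ f k = trans (*ˢ-comm f 1ˢ k) (*ˢ-identityˡ f k)

*ˢ-·ˢ-comm : ∀ c f g → f *ˢ (c ·ˢ g) ≗ c ·ˢ (f *ˢ g)
*ˢ-·ˢ-comm c f g k = begin
  (f *ˢ (c ·ˢ g)) k   ≡⟨ *ˢ-comm f (c ·ˢ g) k ⟩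
  ((c ·ˢ g) *ˢ f) k   ≡⟨ ·ˢ-*ˢ-assoc c g f k ⟩
  c * (g *ˢ f) k      ≡⟨ cong (c *_) (*ˢ-comm g f k) ⟩
  c * (f *ˢ g) k      ∎
  where open ≡-Reasoning

*ˢ-assoc : ∀ f g h → (f *ˢ g) *ˢ h ≗ f *ˢ (g *ˢ h)
*ˢ-assoc f g h zero = ℤ.*-assoc (f 0) (g 0) (h 0)
*ˢ-assoc f g h (suc k) = begin
    (f 0 * g 0) * h (suc k) + ((f 0 ·ˢ tailˢ g +ˢ tailˢ f *ˢ g) *ˢ h) k
  ≡⟨ cong (_+_ ((f 0 * g 0) * h (suc k))) (begin
      ((f 0 ·ˢ tailˢ g +ˢ tailˢ f *ˢ g) *ˢ h) k
    ≡⟨ *ˢ-distribʳ-+ˢ h (f 0 ·ˢ tailˢ g) (tailˢ f *ˢ g) k ⟩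
      ((f 0 ·ˢ tailˢ g) *ˢ h) k + ((tailˢ f *ˢ g) *ˢ h) k
    ≡⟨ cong₂ _+_ (·ˢ-*ˢ-assoc (f 0) (tailˢ g) h k) (*ˢ-assoc (tailˢ f) g h k) ⟩
      f 0 * (tailˢ g *ˢ h) k + (tailˢ f *ˢ (g *ˢ h)) k
    ∎) ⟩
    (f 0 * g 0) * h (suc k) + (f 0 * (tailˢ g *ˢ h) k + (tailˢ f *ˢ (g *ˢ h)) k)
  ≡⟨ regroup (f 0) (g 0) (h (suc k)) _ _ ⟩
    f 0 * (g 0 * h (suc k) + (tailˢ g *ˢ h) k) + (tailˢ f *ˢ (g *ˢ h)) k
  ∎
  where
  open ≡-Reasoning
  regroup : ∀ a b c d e → (a * b) * c + (a * d + e) ≡ a * (b * c + d) + e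
  regroup = solve-∀

1ˢ-^ˢ : ∀ n → 1ˢ ^ˢ n ≗ 1ˢ
1ˢ-^ˢ zero i = refl
1ˢ-^ˢ (suc n) i = trans (*ˢ-identityˡ (1ˢ ^ˢ n) i) (1ˢ-^ˢ n i)

-- Substitution of a power series into a polynomial

eval : Poly → Series → Series
eval [] s = 0ˢ
eval (a ∷ p) s = a ·ˢ 1ˢ +ˢ s *ˢ eval p s

eval-⊕ : ∀ p r s → eval (p ⊕ r) s ≗ eval p s +ˢ eval r s
eval-⊕ [] r s i = sym (ℤ.+-identityˡ _)
eval-⊕ (a ∷ p) [] s i = sym (ℤ.+-identityʳ _)
eval-⊕ (a ∷ p) (b ∷ r) s i = begin
    (a + b) * 1ˢ i + (s *ˢ eval (p ⊕ r) s) i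
  ≡⟨ cong (_+_ ((a + b) * 1ˢ i))
          (trans (*ˢ-congʳ s (eval-⊕ p r s) i) (*ˢ-distribˡ-+ˢ s (eval p s) (eval r s) i)) ⟩
    (a + b) * 1ˢ i + ((s *ˢ eval p s) i + (s *ˢ eval r s) i)
  ≡⟨ [a+b]c+[x+y]≡[ac+x]+[bc+y] a b (1ˢ i) _ _ ⟩
    (a * 1ˢ i + (s *ˢ eval p s) i) + (b * 1ˢ i + (s *ˢ eval r s) i)
  ∎
  where open ≡-Reasoning

eval-scale : ∀ c p s → eval (scale c p) s ≗ c ·ˢ eval p s
eval-scale c [] s i = sym (ℤ.*-zeroʳ c)
eval-scale c (a ∷ p) s i =
  trans (cong (_+_ ((c * a) * 1ˢ i)) (trans (*ˢ-congʳ s (eval-scale c p s) i) (*ˢ-·ˢ-comm c s (eval p s) i)))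
        ([ca]b+cx≡c[ab+x] c a (1ˢ i) _)

eval-⊗ : ∀ p r s → eval (p ⊗ r) s ≗ eval p s *ˢ eval r s
eval-⊗ [] r s i = sym (*ˢ-zeroˡ (eval r s) i)
eval-⊗ (a ∷ p) r s i = begin
    eval (scale a r ⊕ (+ 0 ∷ p ⊗ r)) s i
  ≡⟨ eval-⊕ (scale a r) (+ 0 ∷ p ⊗ r) s i ⟩
    eval (scale a r) s i + (0ℤ * 1ˢ i + (s *ˢ eval (p ⊗ r) s) i)
  ≡⟨ cong₂ _+_ (eval-scale a r s i) (cong₂ _+_ (ℤ.*-zeroˡ (1ˢ i)) (*ˢ-congʳ s (eval-⊗ p r s) i)) ⟩
    a * eval r s i + (0ℤ + (s *ˢ (eval p s *ˢ eval r s)) i)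
  ≡⟨ cong₂ _+_ (sym (trans (·ˢ-*ˢ-assoc a 1ˢ (eval r s) i) (cong (a *_) (*ˢ-identityˡ (eval r s) i))))
               (trans (ℤ.+-identityˡ _) (sym (*ˢ-assoc s (eval p s) (eval r s) i))) ⟩
    ((a ·ˢ 1ˢ) *ˢ eval r s) i + ((s *ˢ eval p s) *ˢ eval r s) i
  ≡⟨ sym (*ˢ-distribʳ-+ˢ (eval r s) (a ·ˢ 1ˢ) (s *ˢ eval p s) i) ⟩
    (eval (a ∷ p) s *ˢ eval r s) i
  ∎
  where open ≡-Reasoning

eval-one : ∀ s → eval (+ 1 ∷ []) s ≗ 1ˢ
eval-one s i = trans (cong (_+_ (+ 1 * 1ˢ i)) (*ˢ-zeroʳ s i)) (trans (ℤ.+-identityʳ _) (ℤ.*-identityˡ (1ˢ i)))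

eval-pow : ∀ p n s → eval (pow p n) s ≗ eval p s ^ˢ n
eval-pow p zero s = eval-one s
eval-pow p (suc n) s i = trans (eval-⊗ p (pow p n) s i) (*ˢ-congʳ (eval p s) (eval-pow p n s) i)

linear : ℤ → Series
linear u = u ·ˢ 1ˢ +ˢ X

eval-linear : ∀ v t → eval (v ∷ + 1 ∷ []) (linear t) ≗ linear (v + t)
eval-linear v t i =
  trans (cong (_+_ (v * 1ˢ i)) (trans (*ˢ-congʳ (linear t) (eval-one (linear t)) i) (*ˢ-identityʳ (linear t) i)))
        (regroup v t (1ˢ i) (X i))
  where
  regroup : ∀ v t d x → v * d + (t * d + x) ≡ (v + t) * d + x
  regroup = solve-∀

tailˢ-linear : ∀ u → tailˢ (linear u) ≗ 1ˢ
tailˢ-linear u zero = cong (_+ 1ℤ) (ℤ.*-zeroʳ u)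
tailˢ-linear u (suc i) = cong (_+ 0ℤ) (ℤ.*-zeroʳ u)

linear-0 : ∀ u → linear u 0 ≡ u
linear-0 u = trans (ℤ.+-identityʳ (u * 1ℤ)) (ℤ.*-identityʳ u)

linear-*ˢ-suc : ∀ u f j → (linear u *ˢ f) (suc j) ≡ u * f (suc j) + f j
linear-*ˢ-suc u f j =
  cong₂ _+_ (cong (_* f (suc j)) (linear-0 u)) (trans (*ˢ-congˡ f (tailˢ-linear u) j) (*ˢ-identityˡ f j))

pascal-^ : ∀ u n j →
  u * (+ (n C suc j) * u ^ (n ∸ suc j)) + + (n C j) * u ^ (n ∸ j) ≡ + (suc n C suc j) * u ^ (n ∸ j)
pascal-^ u n j = trans (split (suc j ≤? n)) (cong (λ c → + c * u ^ (n ∸ j)) (nCk+nC[k+1]≡[n+1]C[k+1] n j))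
  where
  open ≡-Reasoning
  split : Dec (suc j ≤ n) →
    u * (+ (n C suc j) * u ^ (n ∸ suc j)) + + (n C j) * u ^ (n ∸ j) ≡ + (n C j ℕ.+ n C suc j) * u ^ (n ∸ j)
  split (yes j<n) = begin
      u * (+ (n C suc j) * u ^ (n ∸ suc j)) + + (n C j) * u ^ (n ∸ j)
    ≡⟨ cong (λ e → u * (+ (n C suc j) * u ^ (n ∸ suc j)) + + (n C j) * u ^ e) n∸j≡ ⟩
      u * (+ (n C suc j) * u ^ (n ∸ suc j)) + + (n C j) * (u * u ^ (n ∸ suc j))
    ≡⟨ regroup u (+ (n C j)) (+ (n C suc j)) (u ^ (n ∸ suc j)) ⟩
      + (n C j ℕ.+ n C suc j) * (u * u ^ (n ∸ suc j))
    ≡⟨ cong (λ e → + (n C j ℕ.+ n C suc j) * u ^ e) n∸j≡ ⟨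
      + (n C j ℕ.+ n C suc j) * u ^ (n ∸ j)
    ∎
    where
    n∸j≡ : n ∸ j ≡ suc (n ∸ suc j)
    n∸j≡ = ℕ.+-∸-assoc 1 j<n
    regroup : ∀ u a b x → u * (b * x) + a * (u * x) ≡ (a + b) * (u * x)
    regroup = solve-∀
  split (no j≮n) = begin
      u * (+ (n C suc j) * u ^ (n ∸ suc j)) + + (n C j) * u ^ (n ∸ j)
    ≡⟨ cong (λ c → u * (+ c * u ^ (n ∸ suc j)) + + (n C j) * u ^ (n ∸ j)) nC[j+1]≡0 ⟩
      u * (0ℤ * u ^ (n ∸ suc j)) + + (n C j) * u ^ (n ∸ j)
    ≡⟨ regroup u (+ (n C j)) (u ^ (n ∸ suc j)) (u ^ (n ∸ j)) ⟩
      + (n C j) * u ^ (n ∸ j)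
    ≡⟨ cong (λ c → + c * u ^ (n ∸ j)) (trans (cong (n C j ℕ.+_) nC[j+1]≡0) (ℕ.+-identityʳ (n C j))) ⟨
      + (n C j ℕ.+ n C suc j) * u ^ (n ∸ j)
    ∎
    where
    nC[j+1]≡0 : n C suc j ≡ 0
    nC[j+1]≡0 = k>n⇒nCk≡0 (ℕ.≰⇒> j≮n)
    regroup : ∀ u a y z → u * (0ℤ * y) + a * z ≡ a * z
    regroup = solve-∀

-- For j > n the exponent n ∸ j is truncated, harmlessly since n C j = 0.
linear-^ˢ : ∀ u n j → (linear u ^ˢ n) j ≡ + (n C j) * u ^ (n ∸ j)
linear-^ˢ u zero zero = refl
linear-^ˢ u zero (suc j) = refl
linear-^ˢ u (suc n) zero = trans (cong₂ _*_ (linear-0 u) (linear-^ˢ u n 0)) (regroup u (u ^ n))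
  where
  regroup : ∀ u x → u * (1ℤ * x) ≡ 1ℤ * (u * x)
  regroup = solve-∀
linear-^ˢ u (suc n) (suc j) = begin
  (linear u ^ˢ suc n) (suc j)                                         ≡⟨ linear-*ˢ-suc u (linear u ^ˢ n) j ⟩
  u * (linear u ^ˢ n) (suc j) + (linear u ^ˢ n) j                     ≡⟨ cong₂ (λ x y → u * x + y)
                                                                           (linear-^ˢ u n (suc j)) (linear-^ˢ u n j) ⟩
  u * (+ (n C suc j) * u ^ (n ∸ suc j)) + + (n C j) * u ^ (n ∸ j)     ≡⟨ pascal-^ u n j ⟩
  + (suc n C suc j) * u ^ (n ∸ j)                                     ∎
  where open ≡-Reasoning

eval-+F-numerator : ∀ F G s →
  eval (proj₁ (F +F G)) s ≗ eval (proj₁ F) s *ˢ eval (proj₂ G) s +ˢ eval (proj₁ G) s *ˢ eval (proj₂ F) s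
eval-+F-numerator (n₁ , d₁) (n₂ , d₂) s i =
  trans (eval-⊕ (n₁ ⊗ d₂) (n₂ ⊗ d₁) s i) (cong₂ _+_ (eval-⊗ n₁ d₂ s i) (eval-⊗ n₂ d₁ s i))

eval-+F-denominator : ∀ F G s → eval (proj₂ (F +F G)) s ≗ eval (proj₂ F) s *ˢ eval (proj₂ G) s
eval-+F-denominator (n₁ , d₁) (n₂ , d₂) = eval-⊗ d₁ d₂

eval-negF-numerator : ∀ F s → eval (proj₁ (negF F)) s ≗ -1ℤ ·ˢ eval (proj₁ F) s
eval-negF-numerator (n , d) = eval-scale -1ℤ n

eval-pow-one : ∀ n s → eval (pow (+ 1 ∷ []) n) s ≗ 1ˢ
eval-pow-one n s i = trans (eval-pow (+ 1 ∷ []) n s i) (trans (^ˢ-congˡ n (eval-one s) i) (1ˢ-^ˢ n i))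

eval-pow-linear : ∀ v n t → eval (pow (v ∷ + 1 ∷ []) n) (linear t) ≗ linear (v + t) ^ˢ n
eval-pow-linear v n t i = trans (eval-pow (v ∷ + 1 ∷ []) n (linear t) i) (^ˢ-congˡ n (eval-linear v t) i)

module _ (F G : Frac) (s : Series) (F-den≗1 : eval (proj₂ F) s ≗ 1ˢ) (G-den≗1 : eval (proj₂ G) s ≗ 1ˢ) where

  eval-+F-numerator-den≗1 : eval (proj₁ (F +F G)) s ≗ eval (proj₁ F) s +ˢ eval (proj₁ G) s
  eval-+F-numerator-den≗1 i =
    trans (eval-+F-numerator F G s i)
          (cong₂ _+_ (trans (*ˢ-congʳ _ G-den≗1 i) (*ˢ-identityʳ _ i))
                     (trans (*ˢ-congʳ _ F-den≗1 i) (*ˢ-identityʳ _ i)))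

  eval-+F-denominator-den≗1 : eval (proj₂ (F +F G)) s ≗ 1ˢ
  eval-+F-denominator-den≗1 i =
    trans (eval-+F-denominator F G s i) (trans (*ˢ-cong F-den≗1 G-den≗1 i) (*ˢ-identityˡ 1ˢ i))

-- Newton's identities

oneMinusX : ℤ → Series
oneMinusX u zero = 1ℤ
oneMinusX u (suc zero) = - u
oneMinusX u (suc (suc _)) = 0ℤ

-- The k-th coefficient is (−1)^k e_k(us).
elementaryGF : List ℤ → Series
elementaryGF [] = 1ˢ
elementaryGF (u ∷ us) = oneMinusX u *ˢ elementaryGF us

powerSum : List ℤ → ℕ → ℤ
powerSum [] e = 0ℤ
powerSum (u ∷ us) e = u ^ e + powerSum us e

negPowerSumGF : List ℤ → Series
negPowerSumGF us zero = 0ℤ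
negPowerSumGF us (suc j) = - powerSum us (suc j)

θ : Series → Series
θ f j = + j * f j

θ-*ˢ : ∀ f g → θ (f *ˢ g) ≗ θ f *ˢ g +ˢ f *ˢ θ g
θ-*ˢ f g zero = regroup (f 0) (g 0)
  where
  regroup : ∀ a b → 0ℤ * (a * b) ≡ (0ℤ * a) * b + a * (0ℤ * b)
  regroup = solve-∀
θ-*ˢ f g (suc k) = sym (begin
    (0ℤ * f 0) * g (suc k) + (tailˢ (θ f) *ˢ g) k + (f 0 * (+ suc k * g (suc k)) + f′θg)
  ≡⟨ cong (λ e → (0ℤ * f 0) * g (suc k) + e + (f 0 * (+ suc k * g (suc k)) + f′θg)) θtail ⟩
    (0ℤ * f 0) * g (suc k) + (θf′g + f′g) + (f 0 * ((1ℤ + + k) * g (suc k)) + f′θg)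
  ≡⟨ regroup (f 0) (g (suc k)) (+ k) θf′g f′θg f′g ⟩
    (1ℤ + + k) * (f 0 * g (suc k) + f′g) + ((θf′g + f′θg) - + k * f′g)
  ≡⟨ cong (λ e → (1ℤ + + k) * (f 0 * g (suc k) + f′g) + (e - + k * f′g)) (sym (θ-*ˢ (tailˢ f) g k)) ⟩
    (1ℤ + + k) * (f 0 * g (suc k) + f′g) + (+ k * f′g - + k * f′g)
  ≡⟨ trans (cong (_+_ ((1ℤ + + k) * (f 0 * g (suc k) + f′g))) (ℤ.+-inverseʳ (+ k * f′g)))
           (ℤ.+-identityʳ _) ⟩
    + suc k * (f 0 * g (suc k) + f′g)
  ∎)
  where
  open ≡-Reasoning
  θf′g = (θ (tailˢ f) *ˢ g) k
  f′θg = (tailˢ f *ˢ θ g) k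
  f′g = (tailˢ f *ˢ g) k
  θtail : (tailˢ (θ f) *ˢ g) k ≡ θf′g + f′g
  θtail = trans (*ˢ-congˡ g (λ i → trans (ℤ.*-distribʳ-+ (f (suc i)) 1ℤ (+ i))
                                          (cong (_+ (+ i * f (suc i))) (ℤ.*-identityˡ (f (suc i))))) k)
                (trans (*ˢ-distribʳ-+ˢ g (tailˢ f) (θ (tailˢ f)) k) (ℤ.+-comm f′g θf′g))
  regroup : ∀ f₀ g₁ k θf′g f′θg f′g →
    (0ℤ * f₀) * g₁ + (θf′g + f′g) + (f₀ * ((1ℤ + k) * g₁) + f′θg) ≡
    (1ℤ + k) * (f₀ * g₁ + f′g) + ((θf′g + f′θg) - k * f′g)
  regroup = solve-∀

θ-oneMinusX : ∀ u → θ (oneMinusX u) ≗ oneMinusX u *ˢ negPowerSumGF (u ∷ [])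
θ-oneMinusX u zero = refl
θ-oneMinusX u (suc zero) = regroup u
  where
  regroup : ∀ u → + 1 * - u ≡ 1ℤ * - (u * 1ℤ + 0ℤ) + - u * 0ℤ
  regroup = solve-∀
θ-oneMinusX u (suc (suc j)) =
  trans (regroup (+ suc (suc j)) u (u ^ suc j))
        (cong (λ e → 1ℤ * - (u ^ suc (suc j) + 0ℤ) + (- u * - (u ^ suc j + 0ℤ) + e))
              (sym (*ˢ-zeroˡ (negPowerSumGF (u ∷ [])) j)))
  where
  regroup : ∀ n u y → n * 0ℤ ≡ 1ℤ * - (u * y + 0ℤ) + (- u * - (y + 0ℤ) + 0ℤ)
  regroup = solve-∀

negPowerSumGF-∷ : ∀ u us → negPowerSumGF (u ∷ us) ≗ negPowerSumGF (u ∷ []) +ˢ negPowerSumGF us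
negPowerSumGF-∷ u us zero = refl
negPowerSumGF-∷ u us (suc j) = regroup (u ^ suc j) (powerSum us (suc j))
  where
  regroup : ∀ x p → - (x + p) ≡ - (x + 0ℤ) + - p
  regroup = solve-∀

θ-elementaryGF : ∀ us → θ (elementaryGF us) ≗ elementaryGF us *ˢ negPowerSumGF us
θ-elementaryGF [] zero = refl
θ-elementaryGF [] (suc j) = trans (ℤ.*-zeroʳ (+ suc j)) (sym (*ˢ-identityˡ (negPowerSumGF []) (suc j)))
θ-elementaryGF (u ∷ us) j = begin
    θ (F *ˢ R) j
  ≡⟨ θ-*ˢ F R j ⟩
    (θ F *ˢ R) j + (F *ˢ θ R) j
  ≡⟨ cong₂ _+_ (*ˢ-congˡ R (θ-oneMinusX u) j) (*ˢ-congʳ F (θ-elementaryGF us) j) ⟩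
    ((F *ˢ h) *ˢ R) j + (F *ˢ (R *ˢ H)) j
  ≡⟨ cong₂ _+_ (trans (*ˢ-assoc F h R j) (trans (*ˢ-congʳ F (*ˢ-comm h R) j) (sym (*ˢ-assoc F R h j))))
               (sym (*ˢ-assoc F R H j)) ⟩
    ((F *ˢ R) *ˢ h) j + ((F *ˢ R) *ˢ H) j
  ≡⟨ sym (*ˢ-distribˡ-+ˢ (F *ˢ R) h H j) ⟩
    ((F *ˢ R) *ˢ (h +ˢ H)) j
  ≡⟨ *ˢ-congʳ (F *ˢ R) (λ i → sym (negPowerSumGF-∷ u us i)) j ⟩
    ((F *ˢ R) *ˢ negPowerSumGF (u ∷ us)) j
  ∎
  where
  open ≡-Reasoning
  F = oneMinusX u
  R = elementaryGF us
  h = negPowerSumGF (u ∷ [])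
  H = negPowerSumGF us

newton : ∀ us j → + suc j * elementaryGF us (suc j) ≡ (tailˢ (negPowerSumGF us) *ˢ elementaryGF us) j
newton us j = begin
    + suc j * elementaryGF us (suc j)
  ≡⟨ θ-elementaryGF us (suc j) ⟩
    (elementaryGF us *ˢ negPowerSumGF us) (suc j)
  ≡⟨ *ˢ-comm (elementaryGF us) (negPowerSumGF us) (suc j) ⟩
    0ℤ + (tailˢ (negPowerSumGF us) *ˢ elementaryGF us) j
  ≡⟨ ℤ.+-identityˡ _ ⟩
    (tailˢ (negPowerSumGF us) *ˢ elementaryGF us) j
  ∎
  where open ≡-Reasoning

oneMinusX-*ˢ-suc : ∀ u g j → (oneMinusX u *ˢ g) (suc j) ≡ g (suc j) + - u * g j
oneMinusX-*ˢ-suc u g j = cong₂ _+_ (ℤ.*-identityˡ (g (suc j))) (begin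
  (tailˢ (oneMinusX u) *ˢ g) j   ≡⟨ *ˢ-congˡ g tail≗ j ⟩
  (((- u) ·ˢ 1ˢ) *ˢ g) j         ≡⟨ ·ˢ-*ˢ-assoc (- u) 1ˢ g j ⟩
  - u * (1ˢ *ˢ g) j              ≡⟨ cong (- u *_) (*ˢ-identityˡ g j) ⟩
  - u * g j                      ∎)
  where
  open ≡-Reasoning
  tail≗ : tailˢ (oneMinusX u) ≗ (- u) ·ˢ 1ˢ
  tail≗ zero = sym (ℤ.*-identityʳ (- u))
  tail≗ (suc i) = sym (ℤ.*-zeroʳ (- u))

elementaryGF-aboveDegree : ∀ us j → length us < j → elementaryGF us j ≡ 0ℤ
elementaryGF-aboveDegree [] (suc j) _ = refl
elementaryGF-aboveDegree (u ∷ us) (suc j) (s≤s len<j) = begin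
    elementaryGF (u ∷ us) (suc j)
  ≡⟨ oneMinusX-*ˢ-suc u (elementaryGF us) j ⟩
    elementaryGF us (suc j) + - u * elementaryGF us j
  ≡⟨ cong₂ (λ x y → x + - u * y) (elementaryGF-aboveDegree us (suc j) (ℕ.m<n⇒m<1+n len<j))
                                  (elementaryGF-aboveDegree us j len<j) ⟩
    0ℤ + - u * 0ℤ
  ≡⟨ trans (ℤ.+-identityˡ _) (ℤ.*-zeroʳ (- u)) ⟩
    0ℤ
  ∎
  where open ≡-Reasoning

elementaryGF-top : ∀ u us → elementaryGF (u ∷ us) (suc (length us)) ≡ - u * elementaryGF us (length us)
elementaryGF-top u us = trans (oneMinusX-*ˢ-suc u (elementaryGF us) (length us))
  (trans (cong (_+ (- u * elementaryGF us (length us))) (elementaryGF-aboveDegree us (suc (length us)) (ℕ.n<1+n _)))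
         (ℤ.+-identityˡ _))

elementaryGF-0 : ∀ us → elementaryGF us 0 ≡ 1ℤ
elementaryGF-0 [] = refl
elementaryGF-0 (u ∷ us) = trans (ℤ.*-identityˡ _) (elementaryGF-0 us)

-- Congruences modulo q

module Modulo (q : ℕ) where
  open Signed

  infix 4 _≋_
  record _≋_ (x y : ℤ) : Set where
    constructor ≋-intro
    field ∣-difference : + q ∣ x - y
  open _≋_ public

  ∣-resp-≡ : ∀ {x y} → x ≡ y → + q ∣ x → + q ∣ y
  ∣-resp-≡ refl q∣x = q∣x

  ∣0 : + q ∣ 0ℤ
  ∣0 = ∣n⇒∣m*n 0ℤ (∣-refl {+ q})

  ≋-refl : ∀ {x} → x ≋ x
  ≋-refl {x} = ≋-intro (∣-resp-≡ (sym (ℤ.+-inverseʳ x)) ∣0)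

  ≋-reflexive : ∀ {x y} → x ≡ y → x ≋ y
  ≋-reflexive refl = ≋-refl

  ≋-sym : ∀ {x y} → x ≋ y → y ≋ x
  ≋-sym {x} {y} (≋-intro q∣x-y) = ≋-intro (∣-resp-≡ (negate x y) (∣m⇒∣-m q∣x-y))
    where
    negate : ∀ x y → - (x - y) ≡ y - x
    negate = solve-∀

  ≋-trans : ∀ {x y z} → x ≋ y → y ≋ z → x ≋ z
  ≋-trans {x} {y} {z} (≋-intro q∣x-y) (≋-intro q∣y-z) =
    ≋-intro (∣-resp-≡ (telescope x y z) (∣m∣n⇒∣m+n q∣x-y q∣y-z))
    where
    telescope : ∀ x y z → (x - y) + (y - z) ≡ x - z
    telescope = solve-∀

  ≋-setoid : Setoid _ _
  ≋-setoid = record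
    { Carrier = ℤ
    ; _≈_ = _≋_
    ; isEquivalence = record { refl = ≋-refl ; sym = ≋-sym ; trans = ≋-trans }
    }

  +-cong : ∀ {x y x′ y′} → x ≋ x′ → y ≋ y′ → x + y ≋ x′ + y′
  +-cong {x} {y} {x′} {y′} (≋-intro q∣x) (≋-intro q∣y) =
    ≋-intro (∣-resp-≡ (regroup x y x′ y′) (∣m∣n⇒∣m+n q∣x q∣y))
    where
    regroup : ∀ x y x′ y′ → (x - x′) + (y - y′) ≡ (x + y) - (x′ + y′)
    regroup = solve-∀

  *-cong : ∀ {x y x′ y′} → x ≋ x′ → y ≋ y′ → x * y ≋ x′ * y′
  *-cong {x} {y} {x′} {y′} (≋-intro q∣x) (≋-intro q∣y) =
    ≋-intro (∣-resp-≡ (regroup x y x′ y′) (∣m∣n⇒∣m+n (∣n⇒∣m*n x q∣y) (∣m⇒∣m*n y′ q∣x)))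
    where
    regroup : ∀ x y x′ y′ → x * (y - y′) + (x - x′) * y′ ≡ x * y - x′ * y′
    regroup = solve-∀

  -‿cong : ∀ {x y} → x ≋ y → - x ≋ - y
  -‿cong {x} {y} (≋-intro q∣x-y) = ≋-intro (∣-resp-≡ (regroup x y) (∣m⇒∣-m q∣x-y))
    where
    regroup : ∀ x y → - (x - y) ≡ - x - - y
    regroup = solve-∀

  ∣⇒≋0 : ∀ {x} → + q ∣ x → x ≋ 0ℤ
  ∣⇒≋0 {x} q∣x = ≋-intro (∣-resp-≡ (sym (ℤ.+-identityʳ x)) q∣x)

  ≋0⇒∣ : ∀ {x} → x ≋ 0ℤ → + q ∣ x
  ≋0⇒∣ {x} (≋-intro q∣x) = ∣-resp-≡ (ℤ.+-identityʳ x) q∣x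

  ≋-∣ : ∀ {x y} → x ≋ y → + q ∣ x → + q ∣ y
  ≋-∣ x≋y q∣x = ≋0⇒∣ (≋-trans (≋-sym x≋y) (∣⇒≋0 q∣x))

  *ˢ-cong-≋ : ∀ k {f f′ g g′} → (∀ i → i ≤ k → f i ≋ f′ i) → (∀ i → i ≤ k → g i ≋ g′ i) →
              (f *ˢ g) k ≋ (f′ *ˢ g′) k
  *ˢ-cong-≋ zero f≋ g≋ = *-cong (f≋ 0 z≤n) (g≋ 0 z≤n)
  *ˢ-cong-≋ (suc k) f≋ g≋ = +-cong (*-cong (f≋ 0 z≤n) (g≋ (suc k) ℕ.≤-refl))
    (*ˢ-cong-≋ k (λ i i≤k → f≋ (suc i) (s≤s i≤k)) (λ i i≤k → g≋ i (ℕ.m≤n⇒m≤1+n i≤k)))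

  *ˢ-∣ʳ : ∀ k f {g} → (∀ i → i ≤ k → + q ∣ g i) → + q ∣ (f *ˢ g) k
  *ˢ-∣ʳ k f {g} q∣g = ≋0⇒∣ (≋-trans (*ˢ-cong-≋ k (λ _ _ → ≋-refl) (λ i i≤k → ∣⇒≋0 (q∣g i i≤k)))
                                     (≋-reflexive (*ˢ-zeroʳ f k)))

  eval-∣ : ∀ p s → All (+ q Unsigned.∣_) p → ∀ i → + q ∣ eval p s i
  eval-∣ [] s [] i = ∣0
  eval-∣ (a ∷ p) s (q∣a ∷ q∣p) i =
    ∣m∣n⇒∣m+n (∣m⇒∣m*n {m = a} (1ˢ i) (∣ᵤ⇒∣ q∣a)) (*ˢ-∣ʳ i s (λ j _ → eval-∣ p s q∣p j))

  record LowestTerm (f : Series) (k : ℕ) (c : ℤ) : Set where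
    constructor lowestTerm
    field
      ∣-below : ∀ j → j < k → + q ∣ f j
      coefficient : f k ≋ c
  open LowestTerm public

  lowestTerm-≗ : ∀ {f g k c} → f ≗ g → LowestTerm f k c → LowestTerm g k c
  lowestTerm-≗ f≗g (lowestTerm below at) =
    lowestTerm (λ j j<k → ∣-resp-≡ (f≗g j) (below j j<k)) (≋-trans (≋-reflexive (sym (f≗g _))) at)

  lowestTerm-≋ : ∀ {f k c c′} → c ≋ c′ → LowestTerm f k c → LowestTerm f k c′
  lowestTerm-≋ c≋c′ (lowestTerm below at) = lowestTerm below (≋-trans at c≋c′)

  lowestTerm-+ˢ : ∀ {f g k c c′} → LowestTerm f k c → LowestTerm g k c′ → LowestTerm (f +ˢ g) k (c + c′)
  lowestTerm-+ˢ (lowestTerm below at) (lowestTerm below′ at′) =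
    lowestTerm (λ j j<k → ∣m∣n⇒∣m+n (below j j<k) (below′ j j<k)) (+-cong at at′)

  lowestTerm-·ˢ : ∀ {f k c} a → LowestTerm f k c → LowestTerm (a ·ˢ f) k (a * c)
  lowestTerm-·ˢ a (lowestTerm below at) = lowestTerm (λ j j<k → ∣n⇒∣m*n a (below j j<k)) (*-cong (≋-refl {a}) at)

  lowestTerm-lower : ∀ {f k c j} → LowestTerm f k c → j < k → LowestTerm f j 0ℤ
  lowestTerm-lower (lowestTerm below _) j<k =
    lowestTerm (λ i i<j → below i (ℕ.<-trans i<j j<k)) (∣⇒≋0 (below _ j<k))

  lowestTerm-∣ : ∀ {f k c} → (∀ j → + q ∣ f j) → LowestTerm f k c → + q ∣ c
  lowestTerm-∣ q∣f (lowestTerm _ at) = ≋-∣ at (q∣f _)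

  lowestTerm-*ˢ : ∀ k {k′ f g c c′} → LowestTerm f k c → LowestTerm g k′ c′ →
                  LowestTerm (f *ˢ g) (k ℕ.+ k′) (c * c′)
  lowestTerm-*ˢ zero {k′} {f} {g} {c} {c′} (lowestTerm _ f₀≋c) (lowestTerm below at) =
    lowestTerm (λ j j<k′ → *ˢ-∣ʳ j f (λ i i≤j → below i (ℕ.≤-<-trans i≤j j<k′))) (leading k′ below at)
    where
    leading : ∀ k′ → (∀ j → j < k′ → + q ∣ g j) → g k′ ≋ c′ → (f *ˢ g) k′ ≋ c * c′
    leading zero _ at = *-cong f₀≋c at
    leading (suc k′) below at = ≋-trans
      (+-cong (*-cong f₀≋c at) (∣⇒≋0 (*ˢ-∣ʳ k′ (tailˢ f) (λ i i≤k′ → below i (s≤s i≤k′)))))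
      (≋-reflexive (ℤ.+-identityʳ (c * c′)))
  lowestTerm-*ˢ (suc k) {k′} {f} {g} {c} {c′} (lowestTerm below at) Lg =
    lowestTerm below′ (≋-trans (+-cong (∣⇒≋0 (∣m⇒∣m*n _ q∣f₀)) (coefficient tail-lead))
                               (≋-reflexive (ℤ.+-identityˡ (c * c′))))
    where
    q∣f₀ : + q ∣ f 0
    q∣f₀ = below 0 (s≤s z≤n)
    tail-lead : LowestTerm (tailˢ f *ˢ g) (k ℕ.+ k′) (c * c′)
    tail-lead = lowestTerm-*ˢ k (lowestTerm (λ j j<k → below (suc j) (s≤s j<k)) at) Lg
    below′ : ∀ j → j < suc (k ℕ.+ k′) → + q ∣ (f *ˢ g) j
    below′ zero _ = ∣m⇒∣m*n (g 0) q∣f₀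
    below′ (suc j) (s≤s j<) = ∣m∣n⇒∣m+n (∣m⇒∣m*n (g (suc j)) q∣f₀) (∣-below tail-lead j j<)

  lowestTerm-^ˢ : ∀ {f k c} n → LowestTerm f k c → LowestTerm (f ^ˢ n) (n ℕ.* k) (c ^ n)
  lowestTerm-^ˢ zero _ = lowestTerm (λ _ ()) ≋-refl
  lowestTerm-^ˢ {k = k} (suc n) L = lowestTerm-*ˢ k L (lowestTerm-^ˢ n L)

  lowestTerm-1ˢ : LowestTerm 1ˢ 0 1ℤ
  lowestTerm-1ˢ = lowestTerm (λ _ ()) ≋-refl

  lowestTerm-X : LowestTerm X 1 1ℤ
  lowestTerm-X = lowestTerm (λ { zero _ → ∣0 ; (suc _) (s≤s ()) }) ≋-refl

  lowestTerm-linear : ∀ u → LowestTerm (linear u) 0 u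
  lowestTerm-linear u = lowestTerm (λ _ ()) (≋-reflexive (linear-0 u))

  lowestTerm-linear-∣ : ∀ {u} → + q ∣ u → LowestTerm (linear u) 1 1ℤ
  lowestTerm-linear-∣ {u} q∣u =
    lowestTerm (λ { zero _ → ∣-resp-≡ (sym (linear-0 u)) q∣u ; (suc _) (s≤s ()) })
               (≋-reflexive (tailˢ-linear u 0))

module PrimeModulus {q : ℕ} (q-prime : Prime q) where
  open Signed
  open Modulo q

  euclidsLemmaℤ : ∀ x y → + q ∣ x * y → + q ∣ x ⊎ + q ∣ y
  euclidsLemmaℤ x y q∣xy
    with euclidsLemma ℤ.∣ x ∣ ℤ.∣ y ∣ q-prime (subst (q ℕ.∣_) (ℤ.abs-* x y) (∣⇒∣ᵤ q∣xy))
  ... | inj₁ q∣x = inj₁ (∣ᵤ⇒∣ q∣x)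
  ... | inj₂ q∣y = inj₂ (∣ᵤ⇒∣ q∣y)

  ∤-* : ∀ {x y} → ¬ + q ∣ x → ¬ + q ∣ y → ¬ + q ∣ x * y
  ∤-* {x} {y} q∤x q∤y q∣xy with euclidsLemmaℤ x y q∣xy
  ... | inj₁ q∣x = q∤x q∣x
  ... | inj₂ q∣y = q∤y q∣y

  ∤-pos : ∀ {r} → 0 < r → r < q → ¬ + q ∣ + r
  ∤-pos 0<r r<q q∣r = ℕ.<⇒≱ r<q (ℕ.∣⇒≤ ⦃ ℕ.>-nonZero 0<r ⦄ (∣⇒∣ᵤ q∣r))

  ∤-1 : ¬ + q ∣ 1ℤ
  ∤-1 = ∤-pos (s≤s z≤n) (ℕ.nonTrivial⇒n>1 q ⦃ prime⇒nonTrivial q-prime ⦄)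

  ∤-^ : ∀ {x} n → ¬ + q ∣ x → ¬ + q ∣ x ^ n
  ∤-^ zero _ = ∤-1
  ∤-^ (suc n) q∤x = ∤-* q∤x (∤-^ n q∤x)

  ∤-! : ∀ {n} → n < q → ¬ q ℕ.∣ n !
  ∤-! {zero} _ q∣1 = ∤-1 (∣ᵤ⇒∣ q∣1)
  ∤-! {suc n} n<q q∣n! with euclidsLemma (suc n) (n !) q-prime q∣n!
  ... | inj₁ q∣n = ℕ.<⇒≱ n<q (ℕ.∣⇒≤ q∣n)
  ... | inj₂ q∣n! = ∤-! (ℕ.<-trans (ℕ.n<1+n n) n<q) q∣n!

  ∤-C : ∀ {n k} → k ≤ n → n < q → ¬ + q ∣ + (n C k)
  ∤-C {n} {k} k≤n n<q q∣nCk = ∤-! n<q (ℕ.∣-trans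
    (subst (q ℕ.∣_) (nCk≡n!/k![n-k]! k≤n) (∣⇒∣ᵤ q∣nCk))
    (ℕ.m/n∣m ⦃ k ℕ.!* (n ∸ k) !≢0 ⦄ (k![n∸k]!∣n! k≤n)))

  ∣xy∧∤x⇒∣y : ∀ {x y} → ¬ + q ∣ x → + q ∣ x * y → + q ∣ y
  ∣xy∧∤x⇒∣y {x} {y} q∤x q∣xy with euclidsLemmaℤ x y q∣xy
  ... | inj₁ q∣x = ⊥-elim (q∤x q∣x)
  ... | inj₂ q∣y = q∣y

  ∣xy∧∤y⇒∣x : ∀ {x y} → ¬ + q ∣ y → + q ∣ x * y → + q ∣ x
  ∣xy∧∤y⇒∣x {x} {y} q∤y q∣xy = ∣xy∧∤x⇒∣y q∤y (∣-resp-≡ (ℤ.*-comm x y) q∣xy)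

  *-cancelˡ-≋ : ∀ {r x y} → 0 < r → r < q → + r * x ≋ + r * y → x ≋ y
  *-cancelˡ-≋ {r} {x} {y} 0<r r<q (≋-intro q∣rx-ry) =
    ≋-intro (∣xy∧∤x⇒∣y (∤-pos 0<r r<q) (∣-resp-≡ (factor (+ r) x y) q∣rx-ry))
    where
    factor : ∀ r x y → r * x - r * y ≡ r * (x - y)
    factor = solve-∀

  elementaryGF-cong : ∀ {L} us ws → L < q →
    (∀ e → 1 ≤ e → e ≤ L → powerSum us e ≋ powerSum ws e) →
    ∀ j → j ≤ L → elementaryGF us j ≋ elementaryGF ws j
  elementaryGF-cong {L} us ws L<q p≋ j j≤L = agreeUpTo j j≤L j ℕ.≤-refl
    where
    agreeUpTo : ∀ j → j ≤ L → ∀ i → i ≤ j → elementaryGF us i ≋ elementaryGF ws i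
    agreeUpTo zero _ zero z≤n = ≋-reflexive (trans (elementaryGF-0 us) (sym (elementaryGF-0 ws)))
    agreeUpTo (suc j) j<L i i≤1+j with ℕ.m≤n⇒m<n∨m≡n i≤1+j
    ... | inj₁ i<1+j = agreeUpTo j (ℕ.<⇒≤ j<L) i (ℕ.≤-pred i<1+j)
    ... | inj₂ refl = *-cancelˡ-≋ (s≤s z≤n) (ℕ.≤-<-trans j<L L<q) (begin
      + suc j * elementaryGF us (suc j)                      ≡⟨ newton us j ⟩
      (tailˢ (negPowerSumGF us) *ˢ elementaryGF us) j        ≈⟨ *ˢ-cong-≋ j
            (λ i i≤j → -‿cong (p≋ (suc i) (s≤s z≤n) (ℕ.≤-trans (s≤s i≤j) j<L)))
            (agreeUpTo j (ℕ.<⇒≤ j<L)) ⟩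
      (tailˢ (negPowerSumGF ws) *ˢ elementaryGF ws) j        ≡⟨ newton ws j ⟨
      + suc j * elementaryGF ws (suc j)                      ∎)
      where open import Relation.Binary.Reasoning.Setoid ≋-setoid

  elementaryGF-top-∣ : ∀ us → Any (+ q ∣_) us → + q ∣ elementaryGF us (length us)
  elementaryGF-top-∣ (u ∷ us) (here q∣u) =
    ∣-resp-≡ (sym (elementaryGF-top u us)) (∣m⇒∣m*n (elementaryGF us (length us)) (∣m⇒∣-m q∣u))
  elementaryGF-top-∣ (u ∷ us) (there q∣us) =
    ∣-resp-≡ (sym (elementaryGF-top u us)) (∣n⇒∣m*n (- u) (elementaryGF-top-∣ us q∣us))

  elementaryGF-top-∤ : ∀ us → All (λ u → ¬ + q ∣ u) us → ¬ + q ∣ elementaryGF us (length us)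
  elementaryGF-top-∤ [] [] = ∤-1
  elementaryGF-top-∤ (u ∷ us) (q∤u ∷ q∤us) q∣top =
    ∤-* (λ q∣-u → q∤u (∣-resp-≡ (ℤ.neg-involutive u) (∣m⇒∣-m q∣-u))) (elementaryGF-top-∤ us q∤us)
        (∣-resp-≡ (elementaryGF-top u us) q∣top)

powDiff : ℤ → ℤ → ℤ → Frac
powDiff b x y = powF (linF x) b -F powF (linF y) b

powDiffSum : {I : Set} → ℤ → (I → ℤ) → (I → ℤ) → List I → Frac
powDiffSum b a c xs = foldr _+F_ zeroF (map (λ i → powDiff b (a i) (c i)) xs)

module NegativeExponent {q : ℕ} (q-prime : Prime q) (k : ℕ) (t : ℤ) where
  open Signed
  open Modulo q
  open PrimeModulus q-prime

  m : ℕ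
  m = suc k

  -- X^m F(X + t) ≡ ρ + O(X) modulo q, witnessed by an order at which the evaluated denominator
  -- has a unit as lowest coefficient and X^m times the evaluated numerator has its lowest term.
  record PoleCoefficient (F : Frac) (ρ : ℤ) : Set where
    field
      order : ℕ
      leading : ℤ
      leading-∤ : ¬ + q ∣ leading
      denominator-lowest : LowestTerm (eval (proj₂ F) (linear t)) order leading
      numerator-lowest : LowestTerm (X ^ˢ m *ˢ eval (proj₁ F) (linear t)) order (ρ * leading)
  open PoleCoefficient

  poleCoefficient-+F : ∀ {F G ρ₁ ρ₂} → PoleCoefficient F ρ₁ → PoleCoefficient G ρ₂ →
                       PoleCoefficient (F +F G) (ρ₁ + ρ₂)
  poleCoefficient-+F {F} {G} {ρ₁} {ρ₂} PF PG = record
    { order = order PF ℕ.+ order PG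
    ; leading = δ₁ * δ₂
    ; leading-∤ = ∤-* (leading-∤ PF) (leading-∤ PG)
    ; denominator-lowest = lowestTerm-≗ (λ i → sym (eval-+F-denominator F G s i))
        (lowestTerm-*ˢ (order PF) (denominator-lowest PF) (denominator-lowest PG))
    ; numerator-lowest = lowestTerm-≗ (λ i → sym (distribute i))
        (lowestTerm-≋ (≋-reflexive (regroup ρ₁ ρ₂ δ₁ δ₂))
        (lowestTerm-+ˢ (lowestTerm-*ˢ (order PF) (numerator-lowest PF) (denominator-lowest PG))
          (subst (λ n → LowestTerm ((E *ˢ nG) *ˢ dF) n ((ρ₂ * δ₂) * δ₁)) (ℕ.+-comm (order PG) (order PF))
            (lowestTerm-*ˢ (order PG) (numerator-lowest PG) (denominator-lowest PF)))))
    }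
    where
    s = linear t
    E = X ^ˢ m
    δ₁ = leading PF
    δ₂ = leading PG
    nF = eval (proj₁ F) s
    dF = eval (proj₂ F) s
    nG = eval (proj₁ G) s
    dG = eval (proj₂ G) s
    regroup : ∀ ρ₁ ρ₂ δ₁ δ₂ → (ρ₁ * δ₁) * δ₂ + (ρ₂ * δ₂) * δ₁ ≡ (ρ₁ + ρ₂) * (δ₁ * δ₂)
    regroup = solve-∀
    distribute : E *ˢ eval (proj₁ (F +F G)) s ≗ (E *ˢ nF) *ˢ dG +ˢ (E *ˢ nG) *ˢ dF
    distribute i = begin
      (E *ˢ eval (proj₁ (F +F G)) s) i                 ≡⟨ *ˢ-congʳ E (eval-+F-numerator F G s) i ⟩
      (E *ˢ (nF *ˢ dG +ˢ nG *ˢ dF)) i                  ≡⟨ *ˢ-distribˡ-+ˢ E (nF *ˢ dG) (nG *ˢ dF) i ⟩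
      (E *ˢ (nF *ˢ dG)) i + (E *ˢ (nG *ˢ dF)) i        ≡⟨ cong₂ _+_ (*ˢ-assoc E nF dG i) (*ˢ-assoc E nG dF i) ⟨
      ((E *ˢ nF) *ˢ dG) i + ((E *ˢ nG) *ˢ dF) i        ∎
      where open ≡-Reasoning

  poleCoefficient-negF : ∀ {F ρ} → PoleCoefficient F ρ → PoleCoefficient (negF F) (- ρ)
  poleCoefficient-negF {F} {ρ} PF = record
    { order = order PF
    ; leading = leading PF
    ; leading-∤ = leading-∤ PF
    ; denominator-lowest = denominator-lowest PF
    ; numerator-lowest = lowestTerm-≗ (λ i → sym (negate i))
        (lowestTerm-≋ (≋-reflexive (regroup ρ (leading PF))) (lowestTerm-·ˢ -1ℤ (numerator-lowest PF)))
    }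
    where
    regroup : ∀ ρ δ → -1ℤ * (ρ * δ) ≡ - ρ * δ
    regroup = solve-∀
    negate : X ^ˢ m *ˢ eval (proj₁ (negF F)) (linear t) ≗ -1ℤ ·ˢ (X ^ˢ m *ˢ eval (proj₁ F) (linear t))
    negate i = trans (*ˢ-congʳ (X ^ˢ m) (eval-negF-numerator F (linear t)) i) (*ˢ-·ˢ-comm -1ℤ (X ^ˢ m) _ i)

  poleCoefficient-zeroF : PoleCoefficient zeroF 0ℤ
  poleCoefficient-zeroF = record
    { order = 0
    ; leading = 1ℤ
    ; leading-∤ = ∤-1
    ; denominator-lowest = lowestTerm-≗ (λ i → sym (eval-one (linear t) i)) lowestTerm-1ˢ
    ; numerator-lowest = lowestTerm-≗ (λ i → sym (*ˢ-zeroʳ (X ^ˢ m) i)) (lowestTerm (λ _ ()) ≋-refl)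
    }

  lowestTerm-X^m*1 : LowestTerm (X ^ˢ m *ˢ eval (pow (+ 1 ∷ []) m) (linear t)) m 1ℤ
  lowestTerm-X^m*1 =
    lowestTerm-≗ (λ i → sym (trans (*ˢ-congʳ (X ^ˢ m) (eval-pow-one m (linear t)) i) (*ˢ-identityʳ (X ^ˢ m) i)))
    (subst₂ (LowestTerm (X ^ˢ m)) (ℕ.*-identityʳ m) (ℤ.^-zeroˡ m) (lowestTerm-^ˢ m lowestTerm-X))

  poleCoefficient-pole : ∀ {x} → + q ∣ x + t → PoleCoefficient (powF (linF x) -[1+ k ]) 1ℤ
  poleCoefficient-pole {x} q∣x+t = record
    { order = m
    ; leading = 1ℤ
    ; leading-∤ = ∤-1
    ; denominator-lowest = lowestTerm-≗ (λ i → sym (eval-pow-linear x m t i))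
        (subst₂ (LowestTerm (linear (x + t) ^ˢ m)) (ℕ.*-identityʳ m) (ℤ.^-zeroˡ m)
          (lowestTerm-^ˢ m (lowestTerm-linear-∣ q∣x+t)))
    ; numerator-lowest = lowestTerm-X^m*1
    }

  poleCoefficient-regular : ∀ {x} → ¬ + q ∣ x + t → PoleCoefficient (powF (linF x) -[1+ k ]) 0ℤ
  poleCoefficient-regular {x} q∤x+t = record
    { order = 0
    ; leading = (x + t) ^ m
    ; leading-∤ = ∤-^ m q∤x+t
    ; denominator-lowest = lowestTerm-≗ (λ i → sym (eval-pow-linear x m t i))
        (subst (λ n → LowestTerm (linear (x + t) ^ˢ m) n ((x + t) ^ m)) (ℕ.*-zeroʳ m)
          (lowestTerm-^ˢ m (lowestTerm-linear (x + t))))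
    ; numerator-lowest = lowestTerm-≋ (≋-reflexive (sym (ℤ.*-zeroˡ ((x + t) ^ m))))
        (lowestTerm-lower lowestTerm-X^m*1 (s≤s z≤n))
    }

  poleCoefficient-powDiff-pole : ∀ {x y} → + q ∣ x + t → ¬ + q ∣ y + t →
                                 PoleCoefficient (powDiff -[1+ k ] x y) 1ℤ
  poleCoefficient-powDiff-pole q∣x+t q∤y+t =
    poleCoefficient-+F (poleCoefficient-pole q∣x+t) (poleCoefficient-negF (poleCoefficient-regular q∤y+t))

  poleCoefficient-powDiff-regular : ∀ {x y} → ¬ + q ∣ x + t → ¬ + q ∣ y + t →
                                    PoleCoefficient (powDiff -[1+ k ] x y) 0ℤ
  poleCoefficient-powDiff-regular q∤x+t q∤y+t =
    poleCoefficient-+F (poleCoefficient-regular q∤x+t) (poleCoefficient-negF (poleCoefficient-regular q∤y+t))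

  poleCoefficient-∣ : ∀ {F ρ} → FracVanishesMod q F → PoleCoefficient F ρ → + q ∣ ρ
  poleCoefficient-∣ {F} F≡0 PF = ∣xy∧∤y⇒∣x (leading-∤ PF) (lowestTerm-∣ q∣X^m*num (numerator-lowest PF))
    where
    q∣X^m*num : ∀ j → + q ∣ (X ^ˢ m *ˢ eval (proj₁ F) (linear t)) j
    q∣X^m*num j = *ˢ-∣ʳ j (X ^ˢ m) (λ i _ → eval-∣ (proj₁ F) (linear t) F≡0 i)

  module _ {I : Set} (a c : I → ℤ) where

    pole? : ∀ i → Dec (+ q ∣ a i + t)
    pole? i = + q ∣? a i + t

    poleCount : List I → ℕ
    poleCount [] = 0
    poleCount (i ∷ xs) with pole? i
    ... | yes _ = suc (poleCount xs)
    ... | no _ = poleCount xs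

    poleCoefficient-powDiffSum : ∀ xs → All (λ i → ¬ + q ∣ c i + t) xs →
      PoleCoefficient (powDiffSum -[1+ k ] a c xs) (+ poleCount xs)
    poleCoefficient-powDiffSum [] [] = poleCoefficient-zeroF
    poleCoefficient-powDiffSum (i ∷ xs) (q∤cᵢ ∷ q∤cs) with pole? i
    ... | yes q∣aᵢ =
      poleCoefficient-+F (poleCoefficient-powDiff-pole q∣aᵢ q∤cᵢ) (poleCoefficient-powDiffSum xs q∤cs)
    ... | no q∤aᵢ =
      poleCoefficient-+F (poleCoefficient-powDiff-regular q∤aᵢ q∤cᵢ) (poleCoefficient-powDiffSum xs q∤cs)

    poleCount≤length : ∀ xs → poleCount xs ≤ length xs
    poleCount≤length [] = z≤n
    poleCount≤length (i ∷ xs) with pole? i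
    ... | yes _ = s≤s (poleCount≤length xs)
    ... | no _ = ℕ.m≤n⇒m≤1+n (poleCount≤length xs)

    poleCount-pos : ∀ xs → Any (λ i → + q ∣ a i + t) xs → 0 < poleCount xs
    poleCount-pos (i ∷ xs) p with pole? i | p
    ... | yes _ | _ = s≤s z≤n
    ... | no q∤aᵢ | here q∣aᵢ = ⊥-elim (q∤aᵢ q∣aᵢ)
    ... | no _ | there p′ = poleCount-pos xs p′

    negativeExponent-matched : ∀ xs → length xs < q →
      FracVanishesMod q (powDiffSum -[1+ k ] a c xs) →
      Any (λ i → + q ∣ a i + t) xs → ¬ All (λ i → ¬ + q ∣ c i + t) xs
    negativeExponent-matched xs xs<q F≡0 pole q∤cs =
      ∤-pos (poleCount-pos xs pole) (ℕ.≤-<-trans (poleCount≤length xs) xs<q)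
            (poleCoefficient-∣ F≡0 (poleCoefficient-powDiffSum xs q∤cs))

module PositiveExponent {q : ℕ} (q-prime : Prime q) (m : ℕ) (t : ℤ) where
  open Signed
  open Modulo q
  open PrimeModulus q-prime

  powDiff-den≗1 : ∀ x y → eval (proj₂ (powDiff (+ m) x y)) (linear t) ≗ 1ˢ
  powDiff-den≗1 x y = eval-+F-denominator-den≗1 (powF (linF x) (+ m)) (negF (powF (linF y) (+ m))) (linear t)
    (eval-pow-one m (linear t)) (eval-pow-one m (linear t))

  powDiff-coefficient : ∀ x y j → eval (proj₁ (powDiff (+ m) x y)) (linear t) j ≡
    + (m C j) * (x + t) ^ (m ∸ j) + -1ℤ * (+ (m C j) * (y + t) ^ (m ∸ j))
  powDiff-coefficient x y j = begin
      eval (proj₁ (powDiff (+ m) x y)) (linear t) j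
    ≡⟨ eval-+F-numerator-den≗1 (powF (linF x) (+ m)) (negF (powF (linF y) (+ m))) (linear t)
         (eval-pow-one m (linear t)) (eval-pow-one m (linear t)) j ⟩
      eval (pow (x ∷ + 1 ∷ []) m) (linear t) j + eval (proj₁ (negF (powF (linF y) (+ m)))) (linear t) j
    ≡⟨ cong₂ _+_ (binomial x)
                 (trans (eval-negF-numerator (powF (linF y) (+ m)) (linear t) j) (cong (-1ℤ *_) (binomial y))) ⟩
      + (m C j) * (x + t) ^ (m ∸ j) + -1ℤ * (+ (m C j) * (y + t) ^ (m ∸ j))
    ∎
    where
    open ≡-Reasoning
    binomial : ∀ x → eval (pow (x ∷ + 1 ∷ []) m) (linear t) j ≡ + (m C j) * (x + t) ^ (m ∸ j)
    binomial x = trans (eval-pow-linear x m t j) (linear-^ˢ (x + t) m j)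

  module _ {I : Set} (a c : I → ℤ) where

    shifted : (I → ℤ) → List I → List ℤ
    shifted f = map (λ i → f i + t)

    powDiffSum-den≗1 : ∀ xs → eval (proj₂ (powDiffSum (+ m) a c xs)) (linear t) ≗ 1ˢ
    powDiffSum-den≗1 [] = eval-one (linear t)
    powDiffSum-den≗1 (i ∷ xs) = eval-+F-denominator-den≗1 (powDiff (+ m) (a i) (c i)) (powDiffSum (+ m) a c xs)
      (linear t) (powDiff-den≗1 (a i) (c i)) (powDiffSum-den≗1 xs)

    powDiffSum-coefficient : ∀ xs j → eval (proj₁ (powDiffSum (+ m) a c xs)) (linear t) j ≡
      + (m C j) * (powerSum (shifted a xs) (m ∸ j) - powerSum (shifted c xs) (m ∸ j))
    powDiffSum-coefficient [] j = sym (ℤ.*-zeroʳ (+ (m C j)))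
    powDiffSum-coefficient (i ∷ xs) j = begin
        eval (proj₁ (powDiff (+ m) (a i) (c i) +F powDiffSum (+ m) a c xs)) (linear t) j
      ≡⟨ eval-+F-numerator-den≗1 (powDiff (+ m) (a i) (c i)) (powDiffSum (+ m) a c xs) (linear t)
           (powDiff-den≗1 (a i) (c i)) (powDiffSum-den≗1 xs) j ⟩
        eval (proj₁ (powDiff (+ m) (a i) (c i))) (linear t) j + eval (proj₁ (powDiffSum (+ m) a c xs)) (linear t) j
      ≡⟨ cong₂ _+_ (powDiff-coefficient (a i) (c i) j) (powDiffSum-coefficient xs j) ⟩
        (+ (m C j) * (a i + t) ^ (m ∸ j) + -1ℤ * (+ (m C j) * (c i + t) ^ (m ∸ j)))
          + + (m C j) * (powerSum (shifted a xs) (m ∸ j) - powerSum (shifted c xs) (m ∸ j))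
      ≡⟨ regroup (+ (m C j)) _ _ _ _ ⟩
        + (m C j) * (powerSum (shifted a (i ∷ xs)) (m ∸ j) - powerSum (shifted c (i ∷ xs)) (m ∸ j))
      ∎
      where
      open ≡-Reasoning
      regroup : ∀ C x y p r → (C * x + -1ℤ * (C * y)) + C * (p - r) ≡ C * ((x + p) - (y + r))
      regroup = solve-∀

    positiveExponent-matched : ∀ xs → length xs ≤ m → m < q → FracVanishesMod q (powDiffSum (+ m) a c xs) →
      Any (λ i → + q ∣ a i + t) xs → ¬ All (λ i → ¬ + q ∣ c i + t) xs
    positiveExponent-matched xs xs≤m m<q F≡0 pole q∤cs = elementaryGF-top-∤ ws (All.map⁺ q∤cs) q∣topʷ
      where
      us ws : List ℤ
      us = shifted a xs
      ws = shifted c xs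
      powerSums-≋ : ∀ e → 1 ≤ e → e ≤ length xs → powerSum us e ≋ powerSum ws e
      powerSums-≋ e _ e≤xs = ≋-intro
        (subst (λ n → + q ∣ powerSum us n - powerSum ws n) (ℕ.m∸[m∸n]≡n (ℕ.≤-trans e≤xs xs≤m))
          (∣xy∧∤x⇒∣y (∤-C (ℕ.m∸n≤m m e) m<q)
            (∣-resp-≡ (powDiffSum-coefficient xs (m ∸ e))
                      (eval-∣ (proj₁ (powDiffSum (+ m) a c xs)) (linear t) F≡0 (m ∸ e)))))
      top-≋ : elementaryGF us (length xs) ≋ elementaryGF ws (length xs)
      top-≋ = elementaryGF-cong us ws (ℕ.≤-<-trans xs≤m m<q) powerSums-≋ (length xs) ℕ.≤-refl
      q∣topᵘ : + q ∣ elementaryGF us (length xs)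
      q∣topᵘ = subst (λ n → + q ∣ elementaryGF us n) (length-map _ xs) (elementaryGF-top-∣ us (Any.map⁺ pole))
      q∣topʷ : + q ∣ elementaryGF ws (length ws)
      q∣topʷ = subst (λ n → + q ∣ elementaryGF ws n) (sym (length-map _ xs)) (≋-∣ top-≋ q∣topᵘ)

module Matching {q : ℕ} (q-prime : Prime q) {I : Set} (a c : I → ℤ) where
  open Signed

  vanishing⇒matched : ∀ xs n b t → length xs ≤ n → b ℤ.< 0ℤ ⊎ + n ℤ.≤ b → ℤ.∣ b ∣ < q → n < q →
    FracVanishesMod q (powDiffSum b a c xs) →
    Any (λ i → + q ∣ a i + t) xs → ¬ All (λ i → ¬ + q ∣ c i + t) xs
  vanishing⇒matched xs n -[1+ k ] t xs≤n _ _ n<q =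
    NegativeExponent.negativeExponent-matched q-prime k t a c xs (ℕ.≤-<-trans xs≤n n<q)
  vanishing⇒matched xs n (+ m) t xs≤n (inj₂ (ℤ.+≤+ n≤m)) m<q _ =
    PositiveExponent.positiveExponent-matched q-prime m t a c xs (ℕ.≤-trans xs≤n n≤m) m<q
  vanishing⇒matched xs n (+ m) t _ (inj₁ (ℤ.+<+ ()))

-- The statement uses the unsigned divisibility relation, the development the signed one.
open import Data.Nat using (ℕ; _≤_; _<_)
open import Data.Nat.Primality using (Prime)
open import Data.Integer using (ℤ; +_; ∣_∣; _-_) renaming (_<_ to _<ℤ_; _≤_ to _≤ℤ_)
open import Data.Integer.Divisibility using (_∣_)
open import Data.Fin using (Fin; _↑ˡ_; _↑ʳ_)
open import Data.Sum using (_⊎_)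
open import Data.Product using (∃)

lemma5p1 : (b : ℤ) (l : ℕ) → 1 ≤ l → (b <ℤ + 0 ⊎ + l ≤ℤ b) →
    (v : Fin (l Data.Nat.+ l) → ℤ) (q : ℕ) → Prime q → ∣ b ∣ < q → l Data.Nat.+ l < q →
    FracVanishesMod q (Pv l b v) →
    (i : Fin l) → ∃ λ (h : Fin l) → (+ q) ∣ (v (i ↑ˡ l) - v (l ↑ʳ h))
lemma5p1 b l _ b-range v q q-prime ∣b∣<q 2l<q Pv≡0 i =
  decidable-stable (any? λ h → q ℕ.∣? ∣ a i - c h ∣) λ unmatched →
    Matching.vanishing⇒matched q-prime a c (allFin l) l b (- a i)
      (ℕ.≤-reflexive (length-tabulate (λ h → h))) b-range ∣b∣<q (ℕ.≤-<-trans (ℕ.m≤m+n l l) 2l<q) Pv≡0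
      (Any.map (λ { refl → ∣-difference (≋-refl {a i}) }) (∈-allFin i))
      (All.tabulate λ {h} _ q∣cₕ-aᵢ →
        unmatched (h , Signed.∣⇒∣ᵤ (∣-difference (≋-sym (≋-intro {c h} {a i} q∣cₕ-aᵢ)))))
  where
  open Modulo q using (≋-intro; ∣-difference; ≋-refl; ≋-sym)
  a c : Fin l → ℤ
  a h = v (h ↑ˡ l)
  c h = v (l ↑ʳ h)
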